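{- Let $n\ge 3$ and $A=\{1,2,\dots,n\}$. In subset take-away on $A$, any opening move consisting of a 2-element subset $\{i,j\}\subseteq A$ is a losing move: the position resulting from this move is a win for the player who moves next (the second player of the original game).
   Context: Subset take-away on a finite set $A$: two players alternately name proper, non-empty subsets of $A$, with the rule that one may not name a set containing (as a subset, including equality) a set named earlier. A player who is unable to move loses. Equivalently, positions are finite abstract simplicial complexes (collections of non-empty sets closed under taking non-empty subsets); the starting position is the collection of all proper non-empty subsets of $A$, and a move chooses a set $s$ in the current position $X$ and replaces $X$ by $\{a\in X: s\not\subseteq a\}$. -}

module Defs where

open import Data.Nat using (ℕ; zero; suc)
open import Data.Bool using (true; false)
open import Data.List using (List; []; _∷_; filter; map; _++_)
open import Data.List.Membership.Propositional using (_∈_)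
open import Data.Vec using (_∷_; [])
open import Data.Vec.Properties using (≡-dec)
open import Data.Bool.Properties using () renaming (_≟_ to _≟ᵇ_)
open import Data.Fin.Subset using (Subset; _⊆_; ⊥; ⊤)
open import Data.Fin.Subset.Properties using (_⊆?_)
open import Relation.Nullary using (¬?)
open import Relation.Nullary.Decidable using (_×-dec_)

-- Positions of subset take-away on Fin n: finite lists of subsets of Fin n
-- (a simplicial complex, listed explicitly).
Position : ℕ → Set
Position n = List (Subset n)

move : ∀ {n} → Subset n → Position n → Position n
move s X = filter (λ a → ¬? (s ⊆? a)) X

allSubsets : (n : ℕ) → List (Subset n)
allSubsets zero = [] ∷ []
allSubsets (suc n) = map (true ∷_) (allSubsets n) ++ map (false ∷_) (allSubsets n)

start : (n : ℕ) → Position n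
start n = filter (λ s → ¬? (≡-dec _≟ᵇ_ s ⊥) ×-dec ¬? (≡-dec _≟ᵇ_ s ⊤)) (allSubsets n)

data Win {n : ℕ} (X : Position n) : Set
data Lose {n : ℕ} (X : Position n) : Set

data Win {n} X where
  win : (s : Subset n) → s ∈ X → Lose (move s X) → Win X

data Lose {n} X where
  lose : ((s : Subset n) → s ∈ X → Win (move s X)) → Lose X

-- After the opening {i, j} the position X consists of the proper non-empty sets containing at
-- most one of i and j, so it is symmetric under the transposition (i j).  Its free part, the sets
-- avoiding both i and j, is the set of all non-empty subsets of the complement T of {i, j}
-- (non-empty as n ≥ 3); having the greatest element T, it is a first-player win by strategy
-- stealing.  On X the next player follows that winning strategy on the free part and answers every
-- move t meeting {i, j} by its mirror image: this is legal because no set of X contains both i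
-- and j, and it restores the symmetry without touching the free part.

module Submission where

open import Defs
open import Data.Nat using (ℕ; _≤_)
open import Data.Fin.Subset using (Subset; ∣_∣)
open import Relation.Binary.PropositionalEquality using (_≡_)

open import Data.Nat using (_<_)
open import Data.Nat.Properties using (suc-injective; <⇒≱; ≤-<-trans; m∸n≡0⇒m≤n)
open import Data.Nat.Induction using (<-wellFounded)
open import Induction.WellFounded using (Acc; acc)
open import Data.Fin using (Fin; zero; suc; _≟_)
open import Data.Fin.Permutation.Components using (transpose)
open import Data.Fin.Subset using (_∈_; _∉_; _⊆_; ⊥; ⊤; ∁; ⁅_⁆; _∪_; inside; outside)
open import Data.Fin.Subset.Properties
  using ( _⊆?_; _∈?_; ⊆-refl; ⊆-trans; ⊆-antisym; ⊆-reflexive; ⊆⊤; ⊥⊆; ∉⊥; ∈⊤; ∣⊥∣≡0; ∪-identityˡ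
        ; x∈⁅x⁆; x∈⁅y⁆⇒x≡y; x∈p∪q⁺; x∈p∪q⁻; x∈∁p⇒x∉p; x∉p⇒x∈∁p; ∣∁p∣≡n∸∣p∣)
open import Data.Vec using (_∷_; []; tabulate; lookup)
open import Data.Vec.Properties using (≡-dec; lookup∘tabulate; []=⇒lookup; lookup⇒[]=)
open import Data.Bool.Properties using () renaming (_≟_ to _≟ᵇ_)
open import Data.List using (List; []; _∷_; filter; length; map; _++_)
open import Data.List.Properties using (filter-accept; filter-reject; filter-all; filter-notAll; length-filter)
open import Data.List.Membership.Propositional using (find) renaming (_∈_ to _∈ₗ_)
open import Data.List.Membership.Propositional.Properties using (∈-filter⁺; ∈-filter⁻; ∈-map⁺; ∈-++⁺ˡ; ∈-++⁺ʳ)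
open import Data.List.Relation.Unary.Any as Any using (Any; here; there)
open import Data.List.Relation.Unary.All as All using (All; []; _∷_)
open import Data.Product using (∃; ∃₂; _×_; _,_; proj₁; proj₂)
open import Data.Sum as Sum using (_⊎_; inj₁; inj₂; [_,_]′)
open import Function using (_∘_)
open import Level using (Level)
open import Relation.Nullary using (¬_; Dec; yes; no; ¬?; contradiction)
open import Relation.Nullary.Decidable using (_×-dec_)
open import Relation.Unary using (Pred; Decidable)
open import Relation.Binary.PropositionalEquality using (_≢_; refl; sym; trans; cong; subst)

private variable
  ℓ ℓ₁ ℓ₂ : Level
  A : Set ℓ
  n : ℕ
  x : Fin n
  a b s t : Subset n
  X : Position n

filter-comm : {P : Pred A ℓ₁} {Q : Pred A ℓ₂} (P? : Decidable P) (Q? : Decidable Q) (xs : List A) →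
              filter P? (filter Q? xs) ≡ filter Q? (filter P? xs)
filter-comm P? Q? [] = refl
filter-comm P? Q? (x ∷ xs) with P? x | Q? x | filter-comm P? Q? xs
... | yes px | yes qx | ih = trans (filter-accept P? px) (trans (cong (x ∷_) ih) (sym (filter-accept Q? qx)))
... | yes _  | no ¬qx | ih = trans ih (sym (filter-reject Q? ¬qx))
... | no ¬px | yes _  | ih = trans (filter-reject P? ¬px) ih
... | no _   | no _   | ih = ih

All-⊎⇒Any-⊎-All : {P : Pred A ℓ₁} {Q : Pred A ℓ₂} {xs : List A} →
                  All (λ x → P x ⊎ Q x) xs → Any P xs ⊎ All Q xs
All-⊎⇒Any-⊎-All []                 = inj₂ []
All-⊎⇒Any-⊎-All (inj₁ px ∷ _)      = inj₁ (here px)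
All-⊎⇒Any-⊎-All (inj₂ qx ∷ pqxs) = Sum.map there (qx ∷_) (All-⊎⇒Any-⊎-All pqxs)

∈-move⁺ : a ∈ₗ X → ¬ s ⊆ a → a ∈ₗ move s X
∈-move⁺ {s = s} = ∈-filter⁺ (λ a → ¬? (s ⊆? a))

∈-move⁻ : a ∈ₗ move s X → a ∈ₗ X × ¬ s ⊆ a
∈-move⁻ {s = s} {X = X} = ∈-filter⁻ (λ a → ¬? (s ⊆? a)) {xs = X}

move-shortens : s ∈ₗ X → length (move s X) < length X
move-shortens {s = s} {X = X} s∈X =
  filter-notAll (λ a → ¬? (s ⊆? a)) X (Any.map (λ { refl s⊈s → s⊈s ⊆-refl }) s∈X)

move-comm : (s t : Subset n) (X : Position n) → move s (move t X) ≡ move t (move s X)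
move-comm s t = filter-comm (λ a → ¬? (s ⊆? a)) (λ a → ¬? (t ⊆? a))

move-fixes : (∀ {a} → a ∈ₗ X → ¬ s ⊆ a) → move s X ≡ X
move-fixes {s = s} s⊈ = filter-all (λ a → ¬? (s ⊆? a)) (All.tabulate s⊈)

move-absorb : s ⊆ t → move s (move t X) ≡ move s X
move-absorb {s = s} {t = t} {X = X} s⊆t =
  trans (move-comm s t X) (move-fixes (λ a∈ t⊆a → proj₂ (∈-move⁻ {X = X} a∈) (⊆-trans s⊆t t⊆a)))

win-or-lose : (X : Position n) → Win X ⊎ Lose X
win-or-lose X = go X (<-wellFounded (length X))
  where
  go : (X : Position n) → Acc _<_ (length X) → Win X ⊎ Lose X
  go X (acc rec) = Sum.map winning losing (All-⊎⇒Any-⊎-All (All.tabulate outcome-after))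
    where
    outcome-after : ∀ {s} → s ∈ₗ X → Lose (move s X) ⊎ Win (move s X)
    outcome-after {s} s∈X = Sum.swap (go (move s X) (rec (move-shortens s∈X)))
    winning : Any (λ s → Lose (move s X)) X → Win X
    winning some with s , s∈X , s-wins ← find some = win s s∈X s-wins
    losing : All (λ s → Win (move s X)) X → Lose X
    losing all = lose (λ _ s∈X → All.lookup all s∈X)

-- Strategy stealing: a winning reply s to the opening t is itself a winning opening,
-- since s ⊆ t makes the move t redundant after s.
greatest⇒Win : t ∈ₗ X → (∀ {a} → a ∈ₗ X → a ⊆ t) → Win X
greatest⇒Win {t = t} {X = X} t∈X ⊆t with win-or-lose (move t X)
... | inj₂ t-wins = win t t∈X t-wins
... | inj₁ (win s s∈ s-wins) =
  win s s∈X (subst Lose (move-absorb {X = X} (⊆t s∈X)) s-wins)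
  where
  s∈X = proj₁ (∈-move⁻ s∈)

∈-allSubsets : (a : Subset n) → a ∈ₗ allSubsets n
∈-allSubsets []            = here refl
∈-allSubsets (inside ∷ a)  = ∈-++⁺ˡ (∈-map⁺ (inside ∷_) (∈-allSubsets a))
∈-allSubsets (outside ∷ a) = ∈-++⁺ʳ (map (inside ∷_) (allSubsets _)) (∈-map⁺ (outside ∷_) (∈-allSubsets a))

proper? : Decidable (λ (a : Subset n) → a ≢ ⊥ × a ≢ ⊤)
proper? a = ¬? (≡-dec _≟ᵇ_ a ⊥) ×-dec ¬? (≡-dec _≟ᵇ_ a ⊤)

∈-start⁺ : a ≢ ⊥ → a ≢ ⊤ → a ∈ₗ start n
∈-start⁺ {a = a} a≢⊥ a≢⊤ = ∈-filter⁺ proper? (∈-allSubsets a) (a≢⊥ , a≢⊤)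

∈-start⁻ : a ∈ₗ start n → a ≢ ⊥ × a ≢ ⊤
∈-start⁻ {n = n} a∈ = proj₂ (∈-filter⁻ proper? {xs = allSubsets n} a∈)

∣p∣≡0⇒p≡⊥ : {p : Subset n} → ∣ p ∣ ≡ 0 → p ≡ ⊥
∣p∣≡0⇒p≡⊥ {p = []}          _  = refl
∣p∣≡0⇒p≡⊥ {p = outside ∷ p} eq = cong (outside ∷_) (∣p∣≡0⇒p≡⊥ eq)

∣p∣≡1⇒p≡⁅x⁆ : {p : Subset n} → ∣ p ∣ ≡ 1 → ∃ λ x → p ≡ ⁅ x ⁆
∣p∣≡1⇒p≡⁅x⁆ {p = inside ∷ p}  eq = zero , cong (inside ∷_) (∣p∣≡0⇒p≡⊥ (suc-injective eq))
∣p∣≡1⇒p≡⁅x⁆ {p = outside ∷ p} eq with x , refl ← ∣p∣≡1⇒p≡⁅x⁆ {p = p} eq = suc x , refl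

∣p∣≡2⇒p≡⁅x⁆∪⁅y⁆ : {p : Subset n} → ∣ p ∣ ≡ 2 → ∃₂ λ x y → p ≡ ⁅ x ⁆ ∪ ⁅ y ⁆
∣p∣≡2⇒p≡⁅x⁆∪⁅y⁆ {p = inside ∷ p} eq with y , refl ← ∣p∣≡1⇒p≡⁅x⁆ {p = p} (suc-injective eq) =
  zero , suc y , cong (inside ∷_) (sym (∪-identityˡ ⁅ y ⁆))
∣p∣≡2⇒p≡⁅x⁆∪⁅y⁆ {p = outside ∷ p} eq with x , y , refl ← ∣p∣≡2⇒p≡⁅x⁆∪⁅y⁆ {p = p} eq =
  suc x , suc y , refl

∣p∣<n⇒∁p≢⊥ : {p : Subset n} → ∣ p ∣ < n → ∁ p ≢ ⊥
∣p∣<n⇒∁p≢⊥ {n = n} {p = p} ∣p∣<n ∁p≡⊥ =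
  <⇒≱ ∣p∣<n (m∸n≡0⇒m≤n (trans (sym (∣∁p∣≡n∸∣p∣ p)) (trans (cong ∣_∣ ∁p≡⊥) (∣⊥∣≡0 n))))

x∉p⇒p≢⊤ : {p : Subset n} → x ∉ p → p ≢ ⊤
x∉p⇒p≢⊤ x∉p refl = x∉p ∈⊤

module Mirror {n : ℕ} (i j : Fin n) where

  swap : Fin n → Fin n
  swap = transpose i j

  swap-i : swap i ≡ j
  swap-i with i ≟ i
  ... | yes _   = refl
  ... | no i≢i = contradiction refl i≢i

  swap-j : swap j ≡ i
  swap-j with j ≟ i
  ... | yes j≡i = j≡i
  ... | no _ with j ≟ j
  ...   | yes _   = refl
  ...   | no j≢j = contradiction refl j≢j

  swap-fixes : x ≢ i → x ≢ j → swap x ≡ x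
  swap-fixes {x} x≢i x≢j with x ≟ i
  ... | yes x≡i = contradiction x≡i x≢i
  ... | no _ with x ≟ j
  ...   | yes x≡j = contradiction x≡j x≢j
  ...   | no _    = refl

  swap-involutive : (x : Fin n) → swap (swap x) ≡ x
  swap-involutive x = by-cases (x ≟ i) (x ≟ j)
    where
    by-cases : Dec (x ≡ i) → Dec (x ≡ j) → swap (swap x) ≡ x
    by-cases (yes refl) _          = trans (cong swap swap-i) swap-j
    by-cases (no _)     (yes refl) = trans (cong swap swap-j) swap-i
    by-cases (no x≢i)   (no x≢j)   = trans (cong swap (swap-fixes x≢i x≢j)) (swap-fixes x≢i x≢j)

  mirror : Subset n → Subset n
  mirror a = tabulate (λ x → lookup a (swap x))

  ∈-mirror⁺ : swap x ∈ a → x ∈ mirror a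
  ∈-mirror⁺ {x = x} {a = a} sx∈a =
    lookup⇒[]= x (mirror a) (trans (lookup∘tabulate _ x) ([]=⇒lookup sx∈a))

  ∈-mirror⁻ : x ∈ mirror a → swap x ∈ a
  ∈-mirror⁻ {x = x} {a = a} x∈ma =
    lookup⇒[]= (swap x) a (trans (sym (lookup∘tabulate _ x)) ([]=⇒lookup x∈ma))

  swap-∈-mirror : x ∈ a → swap x ∈ mirror a
  swap-∈-mirror {x = x} {a = a} x∈a = ∈-mirror⁺ (subst (_∈ a) (sym (swap-involutive x)) x∈a)

  mirror-adjoint : a ⊆ mirror b → mirror a ⊆ b
  mirror-adjoint {b = b} a⊆mb x∈ma = subst (_∈ b) (swap-involutive _) (∈-mirror⁻ (a⊆mb (∈-mirror⁻ x∈ma)))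

  mirror-reflects-⊆ : mirror a ⊆ mirror b → a ⊆ b
  mirror-reflects-⊆ {b = b} ma⊆mb x∈a = subst (_∈ b) (swap-involutive _) (∈-mirror⁻ (ma⊆mb (swap-∈-mirror x∈a)))

  mirror-injective : mirror a ≡ mirror b → a ≡ b
  mirror-injective eq = ⊆-antisym (mirror-reflects-⊆ (⊆-reflexive eq)) (mirror-reflects-⊆ (⊆-reflexive (sym eq)))

  mirror-⊥ : mirror ⊥ ≡ ⊥
  mirror-⊥ = ⊆-antisym (λ x∈ → contradiction (∈-mirror⁻ x∈) ∉⊥) ⊥⊆

  mirror-⊤ : mirror ⊤ ≡ ⊤
  mirror-⊤ = ⊆-antisym ⊆⊤ (λ _ → ∈-mirror⁺ ∈⊤)

  Avoids : Subset n → Set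
  Avoids a = i ∉ a × j ∉ a

  avoids? : Decidable Avoids
  avoids? a = ¬? (i ∈? a) ×-dec ¬? (j ∈? a)

  avoids-⊆ : a ⊆ b → Avoids b → Avoids a
  avoids-⊆ a⊆b (i∉b , j∉b) = i∉b ∘ a⊆b , j∉b ∘ a⊆b

  avoids⇒⊆mirror : Avoids a → a ⊆ mirror a
  avoids⇒⊆mirror {a = a} (i∉a , j∉a) x∈a =
    ∈-mirror⁺ (subst (_∈ a) (sym (swap-fixes (λ { refl → i∉a x∈a }) (λ { refl → j∉a x∈a }))) x∈a)

  mirror-avoids⇒avoids : Avoids (mirror a) → Avoids a
  mirror-avoids⇒avoids {a = a} (i∉ma , j∉ma) =
    (λ i∈a → j∉ma (∈-mirror⁺ (subst (_∈ a) (sym swap-j) i∈a))) ,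
    (λ j∈a → i∉ma (∈-mirror⁺ (subst (_∈ a) (sym swap-i) j∈a)))

  freePart : Position n → Position n
  freePart = filter avoids?

  ∈-freePart⁺ : a ∈ₗ X → Avoids a → a ∈ₗ freePart X
  ∈-freePart⁺ = ∈-filter⁺ avoids?

  ∈-freePart⁻ : (X : Position n) → a ∈ₗ freePart X → a ∈ₗ X × Avoids a
  ∈-freePart⁻ X = ∈-filter⁻ avoids? {xs = X}

  freePart-move : (t : Subset n) (X : Position n) → move t (freePart X) ≡ freePart (move t X)
  freePart-move t X = filter-comm (λ a → ¬? (t ⊆? a)) avoids? X

  freePart-move-meeting : (X : Position n) → ¬ Avoids t → freePart (move t X) ≡ freePart X
  freePart-move-meeting {t = t} X ¬avoids =
    trans (sym (freePart-move t X))
          (move-fixes (λ a∈ t⊆a → ¬avoids (avoids-⊆ t⊆a (proj₂ (∈-freePart⁻ X a∈)))))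

  MirrorClosed : Position n → Set
  MirrorClosed X = ∀ {a} → a ∈ₗ X → mirror a ∈ₗ X

  Separated : Position n → Set
  Separated X = ∀ {a} → a ∈ₗ X → i ∈ a → j ∉ a

  record Symmetric (X : Position n) : Set where
    field
      mirror-closed : MirrorClosed X
      separated     : Separated X

  open Symmetric

  mirrorClosed-move : MirrorClosed X → t ⊆ mirror t → MirrorClosed (move t X)
  mirrorClosed-move closed t⊆mt a∈ with a∈X , t⊈a ← ∈-move⁻ a∈ =
    ∈-move⁺ (closed a∈X) (λ t⊆ma → t⊈a (⊆-trans t⊆mt (mirror-adjoint t⊆ma)))

  separated-move : Separated X → Separated (move t X)
  separated-move sep a∈ = sep (proj₁ (∈-move⁻ a∈))

  symmetric-move : Symmetric X → t ⊆ mirror t → Symmetric (move t X)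
  symmetric-move X-sym t⊆mt = record
    { mirror-closed = mirrorClosed-move (X-sym .mirror-closed) t⊆mt
    ; separated     = separated-move (X-sym .separated)
    }

  symmetric-move-pair : Symmetric X → Symmetric (move (mirror t) (move t X))
  symmetric-move-pair X-sym = record
    { mirror-closed = closed
    ; separated     = separated-move (separated-move (X-sym .separated))
    }
    where
    closed : MirrorClosed _
    closed a∈ =
      let a∈′ , mt⊈a = ∈-move⁻ a∈
          a∈X , t⊈a  = ∈-move⁻ a∈′
      in ∈-move⁺ (∈-move⁺ (X-sym .mirror-closed a∈X) (mt⊈a ∘ mirror-adjoint)) (t⊈a ∘ mirror-reflects-⊆)

  separated⇒⊈mirror : Separated X → t ∈ₗ X → ¬ Avoids t → ¬ t ⊆ mirror t
  separated⇒⊈mirror {t = t} sep t∈X ¬avoids t⊆mt = ¬avoids (i∉t , j∉t)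
    where
    i∉t : i ∉ t
    i∉t i∈t = sep t∈X i∈t (subst (_∈ t) swap-i (∈-mirror⁻ (t⊆mt i∈t)))
    j∉t : j ∉ t
    j∉t j∈t = sep t∈X (subst (_∈ t) swap-j (∈-mirror⁻ (t⊆mt j∈t))) j∈t

  mirror-Win′  : (X : Position n) → Acc _<_ (length X) → Symmetric X → Win (freePart X) → Win X
  mirror-Lose′ : (X : Position n) → Acc _<_ (length X) → Symmetric X → Lose (freePart X) → Lose X

  mirror-Win′ X (acc rec) X-sym (win t t∈K t-wins) with t∈X , avoids-t ← ∈-freePart⁻ X t∈K =
    win t t∈X (mirror-Lose′ (move t X) (rec (move-shortens t∈X))
                            (symmetric-move X-sym (avoids⇒⊆mirror avoids-t))
                            (subst Lose (freePart-move t X) t-wins))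

  mirror-Lose′ X (acc rec) X-sym (lose K-loses) = lose reply
    where
    reply : (t : Subset n) → t ∈ₗ X → Win (move t X)
    reply t t∈X with avoids? t
    ... | yes avoids-t =
      mirror-Win′ (move t X) (rec (move-shortens t∈X))
                  (symmetric-move X-sym (avoids⇒⊆mirror avoids-t))
                  (subst Win (freePart-move t X) (K-loses t (∈-freePart⁺ t∈X avoids-t)))
    ... | no ¬avoids-t =
      win (mirror t) (∈-move⁺ (X-sym .mirror-closed t∈X) (separated⇒⊈mirror (X-sym .separated) t∈X ¬avoids-t))
          (mirror-Lose′ X″ (rec X″-shorter) (symmetric-move-pair X-sym) (subst Lose (sym freePart-X″) (lose K-loses)))
      where
      X″ : Position n
      X″ = move (mirror t) (move t X)
      X″-shorter : length X″ < length X
      X″-shorter = ≤-<-trans (length-filter _ (move t X)) (move-shortens t∈X)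
      freePart-X″ : freePart X″ ≡ freePart X
      freePart-X″ = trans (freePart-move-meeting (move t X) (¬avoids-t ∘ mirror-avoids⇒avoids))
                          (freePart-move-meeting X ¬avoids-t)

  mirror-Win : Symmetric X → Win (freePart X) → Win X
  mirror-Win {X = X} = mirror-Win′ X (<-wellFounded (length X))

  pair : Subset n
  pair = ⁅ i ⁆ ∪ ⁅ j ⁆

  i∈pair : i ∈ pair
  i∈pair = x∈p∪q⁺ (inj₁ (x∈⁅x⁆ i))

  j∈pair : j ∈ pair
  j∈pair = x∈p∪q⁺ (inj₂ (x∈⁅x⁆ j))

  ∈-pair⁻ : x ∈ pair → x ≡ i ⊎ x ≡ j
  ∈-pair⁻ = Sum.map (x∈⁅y⁆⇒x≡y i) (x∈⁅y⁆⇒x≡y j) ∘ x∈p∪q⁻ ⁅ i ⁆ ⁅ j ⁆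

  pair⊆mirror-pair : pair ⊆ mirror pair
  pair⊆mirror-pair x∈ with ∈-pair⁻ x∈
  ... | inj₁ refl = ∈-mirror⁺ (subst (_∈ pair) (sym swap-i) j∈pair)
  ... | inj₂ refl = ∈-mirror⁺ (subst (_∈ pair) (sym swap-j) i∈pair)

  avoids⇒⊆∁pair : Avoids a → a ⊆ ∁ pair
  avoids⇒⊆∁pair (i∉a , j∉a) x∈a = x∉p⇒x∈∁p (λ x∈pair → [ (λ { refl → i∉a x∈a }) , (λ { refl → j∉a x∈a }) ]′ (∈-pair⁻ x∈pair))

  ∁pair-avoids : Avoids (∁ pair)
  ∁pair-avoids = (λ i∈ → x∈∁p⇒x∉p i∈ i∈pair) , (λ j∈ → x∈∁p⇒x∉p j∈ j∈pair)

  start-mirrorClosed : MirrorClosed (start n)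
  start-mirrorClosed a∈ with a≢⊥ , a≢⊤ ← ∈-start⁻ a∈ =
    ∈-start⁺ (λ ma≡⊥ → a≢⊥ (mirror-injective (trans ma≡⊥ (sym mirror-⊥))))
             (λ ma≡⊤ → a≢⊤ (mirror-injective (trans ma≡⊤ (sym mirror-⊤))))

  move-pair-separated : (X : Position n) → Separated (move pair X)
  move-pair-separated X a∈ i∈a j∈a =
    proj₂ (∈-move⁻ {X = X} a∈) (λ x∈pair → [ (λ { refl → i∈a }) , (λ { refl → j∈a }) ]′ (∈-pair⁻ x∈pair))

  move-pair-symmetric : Symmetric (move pair (start n))
  move-pair-symmetric = record
    { mirror-closed = mirrorClosed-move start-mirrorClosed pair⊆mirror-pair
    ; separated     = move-pair-separated (start n)
    }

  ∁pair∈freePart : ∣ pair ∣ < n → ∁ pair ∈ₗ freePart (move pair (start n))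
  ∁pair∈freePart ∣pair∣<n = ∈-freePart⁺ ∁pair∈X ∁pair-avoids
    where
    i∉∁pair : i ∉ ∁ pair
    i∉∁pair = proj₁ ∁pair-avoids
    ∁pair∈X : ∁ pair ∈ₗ move pair (start n)
    ∁pair∈X = ∈-move⁺ (∈-start⁺ (∣p∣<n⇒∁p≢⊥ ∣pair∣<n) (x∉p⇒p≢⊤ i∉∁pair)) (λ pair⊆∁pair → i∉∁pair (pair⊆∁pair i∈pair))

  freePart⊆∁pair : (X : Position n) → ∀ {a} → a ∈ₗ freePart X → a ⊆ ∁ pair
  freePart⊆∁pair X = avoids⇒⊆∁pair ∘ proj₂ ∘ ∈-freePart⁻ X

mainTheorem3 : (n : ℕ) → 3 ≤ n → (s : Subset n) → ∣ s ∣ ≡ 2 →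
                 Win (move s (start n))
mainTheorem3 n 3≤n s ∣s∣≡2 with i , j , refl ← ∣p∣≡2⇒p≡⁅x⁆∪⁅y⁆ {p = s} ∣s∣≡2 =
  mirror-Win move-pair-symmetric (greatest⇒Win (∁pair∈freePart ∣pair∣<n) (freePart⊆∁pair (move pair (start n))))
  where
  open Mirror i j
  ∣pair∣<n : ∣ pair ∣ < n
  ∣pair∣<n = subst (_< n) (sym ∣s∣≡2) 3≤n
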